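{- Let $\mathbb{F}$ be a field in which the equation $x^2=-1$ has no solution, let $k\ge0$ be an integer and $d=2k+1$, and consider the bilinear form $\langle\cdot,\cdot\rangle_d$ on $\mathbb{F}^d$. Then there is no pair $(V,w)$ where $V\subseteq\mathbb{F}^d$ is a totally isotropic affine flat of dimension $k$ and $w\in\mathbb{F}^d$ is a vector with $\langle w,w\rangle_d=1$ that is orthogonal to $V$.
   Context: The form $\langle u,v\rangle_d$ on $\mathbb{F}^d$ is $u_1v_1+\dots+u_dv_d$ if $d\not\equiv1\pmod 4$, and $u_1v_1+\dots+u_{d-1}v_{d-1}-u_dv_d$ if $d\equiv1\pmod4$. An affine flat $V$ is totally isotropic if $\langle x-y,x-y\rangle_d=0$ for all $x,y\in V$. A vector $w$ is orthogonal to $V$ if $\langle w, x-y\rangle_d=0$ for all $x,y\in V$. -}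

module Defs where

open import Level using (Level; _⊔_; suc)
open import Algebra.Bundles using (CommutativeRing)
open import Data.Nat.Base as ℕ using (ℕ; _%_)
open import Data.Nat.Properties using () renaming (_≟_ to _≟ℕ_)
open import Data.Fin.Base using (Fin; toℕ)
open import Data.Product using (Σ; ∃; _×_; _,_)
open import Relation.Nullary using (¬_; yes; no)
import Algebra.Definitions.RawMonoid as RM

record Field (c ℓ : Level) : Set (suc (c ⊔ ℓ)) where
  field
    commutativeRing : CommutativeRing c ℓ
  open CommutativeRing commutativeRing public
  field
    0≉1     : ¬ (0# ≈ 1#)
    inverse : ∀ x → ¬ (x ≈ 0#) → ∃ λ y → x * y ≈ 1#

module _ {c ℓ : Level} (F : Field c ℓ) where
  open Field F

  Vec : ℕ → Set c
  Vec d = Fin d → Carrier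

  Σᶠ : ∀ {n} → (Fin n → Carrier) → Carrier
  Σᶠ = RM.sum +-rawMonoid

  _⊕_ : ∀ {d} → Vec d → Vec d → Vec d
  (u ⊕ v) i = u i + v i

  _⊖_ : ∀ {d} → Vec d → Vec d → Vec d
  (u ⊖ v) i = u i - v i

  sign : (d : ℕ) → Fin d → Carrier
  sign d i with d % 4 ≟ℕ 1 | ℕ.suc (toℕ i) ≟ℕ d
  ... | yes _ | yes _ = - 1#
  ... | _     | _     = 1#

  ⟨_,_⟩ : ∀ {d} → Vec d → Vec d → Carrier
  ⟨_,_⟩ {d} u v = Σᶠ (λ i → sign d i * (u i * v i))

  lincomb : ∀ {d k} → (Fin k → Carrier) → (Fin k → Vec d) → Vec d
  lincomb cs b i = Σᶠ (λ j → cs j * b j i)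

  LinearlyIndependent : ∀ {d k} → (Fin k → Vec d) → Set (c ⊔ ℓ)
  LinearlyIndependent {d} {k} b =
    ∀ (cs : Fin k → Carrier) → (∀ i → lincomb cs b i ≈ 0#) → ∀ j → cs j ≈ 0#

  record AffineFlat (d k : ℕ) : Set (c ⊔ ℓ) where
    field
      base       : Vec d
      directions : Fin k → Vec d
      independent : LinearlyIndependent directions

  _∈_ : ∀ {d k} → Vec d → AffineFlat d k → Set (c ⊔ ℓ)
  x ∈ V = ∃ λ (cs : Fin _ → Carrier) →
            ∀ i → x i ≈ (AffineFlat.base V ⊕ lincomb cs (AffineFlat.directions V)) i

  TotallyIsotropic : ∀ {d k} → AffineFlat d k → Set (c ⊔ ℓ)
  TotallyIsotropic V = ∀ x y → x ∈ V → y ∈ V → ⟨ x ⊖ y , x ⊖ y ⟩ ≈ 0#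

  OrthogonalTo : ∀ {d k} → Vec d → AffineFlat d k → Set (c ⊔ ℓ)
  OrthogonalTo w V = ∀ x y → x ∈ V → y ∈ V → ⟨ w , x ⊖ y ⟩ ≈ 0#

{-# OPTIONS --safe #-}
module Submission where

-- Adjoin a coordinate with coefficient −1: the vectors (1, w) and (0, b_j), for the directions b_j of V,
-- span a (k+1)-dimensional totally isotropic subspace of the nondegenerate diagonal form −x₀² + ⟨x,x⟩_d
-- in 2k+2 variables.  A form in 2m variables with an m-dimensional totally isotropic subspace is
-- hyperbolic, so its discriminant (−1)^m·det is a square; here it is −1, which is not.
-- The hyperbolic case is proved for diagonal forms by induction on m: rotations in a coordinate plane
-- (changing det by a square) concentrate one isotropic basis vector on two coordinates, which then split
-- off as a hyperbolic plane with −a₀a₁ a square.  Equality in the field is not decidable, so every case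
-- distinction is made under a double negation.

open import Level using (Level; _⊔_)
open import Algebra.Bundles using (CommutativeRing; CommutativeMonoid)
open import Algebra.Solver.Ring.AlmostCommutativeRing using (fromCommutativeRing; _-Raw-AlmostCommutative⟶_)
open import Data.Fin.Base using (Fin; zero; suc; toℕ; fromℕ<)
open import Data.Fin.Properties using (suc-injective; _≟_; toℕ-fromℕ<; toℕ-injective)
open import Data.Integer.Base as ℤ using (ℤ; +_; -[1+_])
import Data.Integer.Properties as ℤ
open import Data.Maybe.Base using (Maybe; just; nothing)
open import Data.Nat.Base as ℕ using (ℕ; zero; suc; _%_)
import Data.Nat.Properties as ℕ
open import Data.Nat.DivMod using (%-distribˡ-+)
open import Data.Product using (Σ; ∃; _×_; _,_; proj₁; proj₂)
open import Data.Sign.Base as Sign using (Sign)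
open import Data.Sum using (_⊎_; inj₁; inj₂)
open import Data.Vec.Functional using (Vector; tail; _∷_; updateAt)
open import Data.Vec.Functional.Properties using (updateAt-updates; updateAt-minimal)
open import Function.Base using (_∘_; const)
open import Relation.Binary.PropositionalEquality as ≡ using (_≡_; _≢_)
open import Relation.Nullary using (¬_)
open import Relation.Nullary.Decidable using (yes; no; ¬¬-excluded-middle)
open import Relation.Nullary.Negation using (contradiction)

open import Defs

-- The ring solvers of the library need coefficients with a (weakly) decidable equality; the integers,
-- interpreted in any commutative ring, provide them.
module IntegerCoefficientSolver {c ℓ : Level} (R : CommutativeRing c ℓ) where
  open CommutativeRing R
  open import Algebra.Properties.Ring ring
    using (-0#≈0#; -‿involutive; -‿+-comm; -‿anti-homo-+; -‿distribˡ-*; -‿distribʳ-*; xyx⁻¹≈y)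
  open import Algebra.Properties.Semiring.Mult semiring using (×-homo-+; ×1-homo-*) renaming (_×_ to _×ₙ_)
  open import Relation.Binary.Reasoning.Setoid setoid

  private
    ⟦_⟧ : ℤ → Carrier
    ⟦ + n ⟧      = n ×ₙ 1#
    ⟦ -[1+ n ] ⟧ = - (suc n ×ₙ 1#)

    ⟦⊖⟧ : ∀ m n → ⟦ m ℤ.⊖ n ⟧ ≈ m ×ₙ 1# - n ×ₙ 1#
    ⟦⊖⟧ zero    zero    = sym (-‿inverseʳ 0#)
    ⟦⊖⟧ zero    (suc n) = sym (+-identityˡ _)
    ⟦⊖⟧ (suc m) zero    = sym (trans (+-congˡ -0#≈0#) (+-identityʳ _))
    ⟦⊖⟧ (suc m) (suc n) = begin
      ⟦ suc m ℤ.⊖ suc n ⟧     ≡⟨ ≡.cong ⟦_⟧ (ℤ.[1+m]⊖[1+n]≡m⊖n m n) ⟩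
      ⟦ m ℤ.⊖ n ⟧             ≈⟨ ⟦⊖⟧ m n ⟩
      x - y                   ≈⟨ +-congʳ (xyx⁻¹≈y 1# x) ⟨
      (1# + x - 1#) - y       ≈⟨ +-assoc (1# + x) (- 1#) (- y) ⟩
      (1# + x) + (- 1# - y)   ≈⟨ +-congˡ (-‿anti-homo-+ y 1#) ⟨
      (1# + x) - (y + 1#)     ≈⟨ +-congˡ (-‿cong (+-comm y 1#)) ⟩
      (1# + x) - (1# + y)     ∎
      where
      x y : Carrier
      x = m ×ₙ 1#
      y = n ×ₙ 1#

    ⟦+⟧ : ∀ i j → ⟦ i ℤ.+ j ⟧ ≈ ⟦ i ⟧ + ⟦ j ⟧
    ⟦+⟧ (+ m)    (+ n)    = ×-homo-+ 1# m n
    ⟦+⟧ (+ m)    -[1+ n ] = ⟦⊖⟧ m (suc n)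
    ⟦+⟧ -[1+ m ] (+ n)    = trans (⟦⊖⟧ n (suc m)) (+-comm _ _)
    ⟦+⟧ -[1+ m ] -[1+ n ] = begin
      - (suc (suc (m ℕ.+ n)) ×ₙ 1#)     ≡⟨ ≡.cong (λ k → - (suc k ×ₙ 1#)) (ℕ.+-suc m n) ⟨
      - ((suc m ℕ.+ suc n) ×ₙ 1#)       ≈⟨ -‿cong (×-homo-+ 1# (suc m) (suc n)) ⟩
      - (suc m ×ₙ 1# + suc n ×ₙ 1#)     ≈⟨ -‿+-comm _ _ ⟨
      - (suc m ×ₙ 1#) - (suc n ×ₙ 1#)   ∎

    ⟦-⟧ : ∀ i → ⟦ ℤ.- i ⟧ ≈ - ⟦ i ⟧
    ⟦-⟧ (+ zero)  = sym -0#≈0#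
    ⟦-⟧ (+ suc n) = refl
    ⟦-⟧ -[1+ n ]  = sym (-‿involutive _)

    ⟦+◃⟧ : ∀ n → ⟦ Sign.+ ℤ.◃ n ⟧ ≈ n ×ₙ 1#
    ⟦+◃⟧ n = reflexive (≡.cong ⟦_⟧ (ℤ.+◃n≡+n n))

    ⟦-◃⟧ : ∀ n → ⟦ Sign.- ℤ.◃ n ⟧ ≈ - (n ×ₙ 1#)
    ⟦-◃⟧ n = trans (reflexive (≡.cong ⟦_⟧ (ℤ.-◃n≡-n n))) (⟦-⟧ (+ n))

    ⟦*⟧ : ∀ i j → ⟦ i ℤ.* j ⟧ ≈ ⟦ i ⟧ * ⟦ j ⟧
    ⟦*⟧ (+ m)    (+ n)    = trans (⟦+◃⟧ (m ℕ.* n)) (×1-homo-* m n)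
    ⟦*⟧ (+ m)    -[1+ n ] =
      trans (⟦-◃⟧ (m ℕ.* suc n)) (trans (-‿cong (×1-homo-* m (suc n))) (-‿distribʳ-* _ _))
    ⟦*⟧ -[1+ m ] (+ n)    =
      trans (⟦-◃⟧ (suc m ℕ.* n)) (trans (-‿cong (×1-homo-* (suc m) n)) (-‿distribˡ-* _ _))
    ⟦*⟧ -[1+ m ] -[1+ n ] = begin
      ⟦ Sign.+ ℤ.◃ (suc m ℕ.* suc n) ⟧   ≈⟨ ⟦+◃⟧ (suc m ℕ.* suc n) ⟩
      (suc m ℕ.* suc n) ×ₙ 1#            ≈⟨ ×1-homo-* (suc m) (suc n) ⟩
      x * y                              ≈⟨ -‿involutive (x * y) ⟨
      - - (x * y)                        ≈⟨ -‿cong (-‿distribˡ-* x y) ⟩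
      - (- x * y)                        ≈⟨ -‿distribʳ-* (- x) y ⟩
      - x * - y                          ∎
      where
      x y : Carrier
      x = suc m ×ₙ 1#
      y = suc n ×ₙ 1#

    homomorphism : ℤ.+-*-rawRing -Raw-AlmostCommutative⟶ fromCommutativeRing R
    homomorphism = record
      { ⟦_⟧ = ⟦_⟧ ; +-homo = ⟦+⟧ ; *-homo = ⟦*⟧ ; -‿homo = ⟦-⟧
      ; 0-homo = refl ; 1-homo = +-identityʳ 1#
      }

    ⟦⟧-weaklyDecidable : ∀ i j → Maybe (⟦ i ⟧ ≈ ⟦ j ⟧)
    ⟦⟧-weaklyDecidable i j with i ℤ.≟ j
    ... | yes ≡.refl = just refl
    ... | no _       = nothing

  open import Algebra.Solver.Ring ℤ.+-*-rawRing (fromCommutativeRing R) homomorphism ⟦⟧-weaklyDecidable public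
    using (solve; con; _:+_; _:*_; :-_; _:=_)

module SumOffPoints {c ℓ : Level} (M : CommutativeMonoid c ℓ) where
  open CommutativeMonoid M
  open import Algebra.Properties.CommutativeMonoid.Sum M using (sum; sum-cong-≋; sum-replicate-zero)
  open import Algebra.Properties.CommutativeSemigroup commutativeSemigroup using (x∙yz≈y∙xz)
  open import Relation.Binary.Reasoning.Setoid setoid

  sum-≈ε : ∀ {n} {f : Vector Carrier n} → (∀ i → f i ≈ ε) → sum f ≈ ε
  sum-≈ε {n} f≈ε = trans (sum-cong-≋ f≈ε) (sum-replicate-zero n)

  sum-≈ε-off : ∀ {n} {f : Vector Carrier n} p → (∀ i → i ≢ p → f i ≈ ε) → sum f ≈ f p
  sum-≈ε-off zero    f≈ε = trans (∙-congˡ (sum-≈ε λ i → f≈ε (suc i) λ ())) (identityʳ _)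
  sum-≈ε-off (suc p) f≈ε =
    trans (∙-cong (f≈ε zero λ ()) (sum-≈ε-off p λ i i≢p → f≈ε (suc i) (i≢p ∘ suc-injective)))
          (identityˡ _)

  sum-cong-off₁ : ∀ {n} {f g : Vector Carrier n} p {x y} → (∀ i → i ≢ p → f i ≈ g i) →
                  x ∙ f p ≈ y ∙ g p → x ∙ sum f ≈ y ∙ sum g
  sum-cong-off₁ {f = f} {g} zero {x} {y} f≈g xf≈yg = begin
    x ∙ (f zero ∙ sum (f ∘ suc))   ≈⟨ assoc x _ _ ⟨
    (x ∙ f zero) ∙ sum (f ∘ suc)   ≈⟨ ∙-cong xf≈yg (sum-cong-≋ λ i → f≈g (suc i) λ ()) ⟩
    (y ∙ g zero) ∙ sum (g ∘ suc)   ≈⟨ assoc y _ _ ⟩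
    y ∙ (g zero ∙ sum (g ∘ suc))   ∎
  sum-cong-off₁ (suc p) f≈g xf≈yg = trans (x∙yz≈y∙xz _ _ _) (trans
    (∙-cong (f≈g zero λ ()) (sum-cong-off₁ p (λ i i≢p → f≈g (suc i) (i≢p ∘ suc-injective)) xf≈yg))
    (x∙yz≈y∙xz _ _ _))

  sum-cong-off₂ : ∀ {n} {f g : Vector Carrier n} {p q x y} → p ≢ q →
                  (∀ i → i ≢ p → i ≢ q → f i ≈ g i) → x ∙ (f p ∙ f q) ≈ y ∙ (g p ∙ g q) →
                  x ∙ sum f ≈ y ∙ sum g
  sum-cong-off₂ {p = zero}  {zero}  p≢q _ _ = contradiction ≡.refl p≢q
  sum-cong-off₂ {f = f} {g} {zero} {suc q} {x} {y} _ f≈g eq = begin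
    x ∙ (f zero ∙ sum (f ∘ suc))   ≈⟨ assoc x _ _ ⟨
    (x ∙ f zero) ∙ sum (f ∘ suc)   ≈⟨ sum-cong-off₁ q
                                        (λ i i≢q → f≈g (suc i) (λ ()) (i≢q ∘ suc-injective))
                                        (trans (assoc x _ _) (trans eq (sym (assoc y _ _)))) ⟩
    (y ∙ g zero) ∙ sum (g ∘ suc)   ≈⟨ assoc y _ _ ⟩
    y ∙ (g zero ∙ sum (g ∘ suc))   ∎
  sum-cong-off₂ {p = suc p} {zero} p≢q f≈g eq =
    sum-cong-off₂ (p≢q ∘ ≡.sym) (λ i i≢q i≢p → f≈g i i≢p i≢q)
      (trans (∙-congˡ (comm _ _)) (trans eq (∙-congˡ (comm _ _))))
  sum-cong-off₂ {p = suc p} {suc q} p≢q f≈g eq = trans (x∙yz≈y∙xz _ _ _) (trans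
    (∙-cong (f≈g zero (λ ()) (λ ()))
            (sum-cong-off₂ (p≢q ∘ ≡.cong suc)
              (λ i i≢p i≢q → f≈g (suc i) (i≢p ∘ suc-injective) (i≢q ∘ suc-injective)) eq))
    (x∙yz≈y∙xz _ _ _))

update₂ : ∀ {a} {A : Set a} {n} → Vector A n → Fin n → A → Fin n → A → Vector A n
update₂ f p u q w = updateAt (updateAt f q (const w)) p (const u)

module _ {a} {A : Set a} {n} (f : Vector A n) {p : Fin n} {u : A} {q : Fin n} {w : A} where

  update₂-first : update₂ f p u q w p ≡ u
  update₂-first = updateAt-updates p _

  update₂-second : p ≢ q → update₂ f p u q w q ≡ w
  update₂-second p≢q = ≡.trans (updateAt-minimal q p _ (p≢q ∘ ≡.sym)) (updateAt-updates q f)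

  update₂-minimal : ∀ i → i ≢ p → i ≢ q → update₂ f p u q w i ≡ f i
  update₂-minimal i i≢p i≢q = ≡.trans (updateAt-minimal i p _ i≢p) (updateAt-minimal i q f i≢q)

¬¬-establish-∀ : ∀ {a p} {S : Set a} {N} (Z : Fin N → S → Set p) →
                 (∀ i s → ¬ ¬ (∃ λ s′ → Z i s′ × (∀ j → j ≢ i → Z j s → Z j s′))) →
                 S → ¬ ¬ (∃ λ s → ∀ i → Z i s)
¬¬-establish-∀ {N = zero}  Z step s k = k (s , λ ())
¬¬-establish-∀ {N = suc N} Z step s k =
  ¬¬-establish-∀ (Z ∘ suc) step-suc s λ (s₁ , Z-suc) →
  step zero s₁ λ (s₂ , Z-zero , keep) →
  k (s₂ , λ { zero → Z-zero ; (suc i) → keep (suc i) (λ ()) (Z-suc i) })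
  where
  step-suc : ∀ i s → ¬ ¬ (∃ λ s′ → Z (suc i) s′ × (∀ j → j ≢ i → Z (suc j) s → Z (suc j) s′))
  step-suc i s k = step (suc i) s λ (s′ , Zi , keep) →
    k (s′ , Zi , λ j j≢i → keep (suc j) (j≢i ∘ suc-injective))

double : ℕ → ℕ
double zero    = zero
double (suc m) = suc (suc (double m))

suc-odd≡double : ∀ k → suc (2 ℕ.* k ℕ.+ 1) ≡ double (suc k)
suc-odd≡double zero    = ≡.refl
suc-odd≡double (suc k) =
  ≡.cong suc (≡.trans (≡.cong (ℕ._+ 1) (ℕ.*-suc 2 k)) (≡.cong suc (suc-odd≡double k)))

odd%4-step : ∀ k {r} → (2 ℕ.* k ℕ.+ 1) % 4 ≡ r → (2 ℕ.* suc k ℕ.+ 1) % 4 ≡ (2 ℕ.+ r) % 4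
odd%4-step k ≡r = ≡.trans (≡.cong (λ x → (x ℕ.+ 1) % 4) (ℕ.*-suc 2 k))
                          (≡.trans (%-distribˡ-+ 2 (2 ℕ.* k ℕ.+ 1) 4) (≡.cong (λ r → (2 ℕ.+ r) % 4) ≡r))

module QuadraticSpaces {c ℓ : Level} (F : Field c ℓ) where
  open Field F hiding (zero)
  open import Algebra.Properties.Ring ring using (-0#≈0#; -‿involutive; -1*x≈-x; +-inverseˡ-unique)
  open import Algebra.Properties.Semiring.Sum semiring
    using (sum-cong-≋; ∑-distrib-+; *-distribˡ-sum; *-distribʳ-sum)
  open import Algebra.Properties.Semiring.Exp semiring using (_^_)
  open import Algebra.Properties.CommutativeSemigroup *-commutativeSemigroup using (x∙yz≈y∙xz)
  open import Algebra.Definitions.RawMonoid *-rawMonoid using () renaming (sum to ∏)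
  open IntegerCoefficientSolver commutativeRing using (solve; con; _:+_; _:*_; :-_; _:=_)
  open SumOffPoints +-commutativeMonoid using (sum-≈ε; sum-≈ε-off; sum-cong-off₂)
  private module ∏ = SumOffPoints *-commutativeMonoid
  open import Relation.Binary.Reasoning.Setoid setoid

  1≉0 : 1# ≉ 0#
  1≉0 = 0≉1 ∘ sym

  x≉0∧x*y≈0⇒y≈0 : ∀ {x y} → x ≉ 0# → x * y ≈ 0# → y ≈ 0#
  x≉0∧x*y≈0⇒y≈0 {x} {y} x≉0 xy≈0 = let (x⁻¹ , xx⁻¹≈1) = inverse x x≉0 in begin
    y               ≈⟨ *-identityˡ y ⟨
    1# * y          ≈⟨ *-congʳ xx⁻¹≈1 ⟨
    (x * x⁻¹) * y   ≈⟨ solve 3 (λ x x⁻¹ y → (x :* x⁻¹) :* y := x⁻¹ :* (x :* y)) refl x x⁻¹ y ⟩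
    x⁻¹ * (x * y)   ≈⟨ *-congˡ xy≈0 ⟩
    x⁻¹ * 0#        ≈⟨ zeroʳ x⁻¹ ⟩
    0#              ∎

  *-≉0 : ∀ {x y} → x ≉ 0# → y ≉ 0# → x * y ≉ 0#
  *-≉0 x≉0 y≉0 = y≉0 ∘ x≉0∧x*y≈0⇒y≈0 x≉0

  -‿≉0 : ∀ {x} → x ≉ 0# → - x ≉ 0#
  -‿≉0 {x} x≉0 -x≈0 = x≉0 (trans (sym (-‿involutive x)) (trans (-‿cong -x≈0) -0#≈0#))

  x*y≈1⇒x≉0 : ∀ {x y} → x * y ≈ 1# → x ≉ 0#
  x*y≈1⇒x≉0 {x} {y} xy≈1 x≈0 = 1≉0 (trans (sym xy≈1) (trans (*-congʳ x≈0) (zeroˡ y)))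

  x*y≈1⇒y≉0 : ∀ {x y} → x * y ≈ 1# → y ≉ 0#
  x*y≈1⇒y≉0 {x} {y} xy≈1 = x*y≈1⇒x≉0 (trans (*-comm y x) xy≈1)

  x*s+y*t≈0 : ∀ x y {s t} → s ≈ 0# → t ≈ 0# → x * s + y * t ≈ 0#
  x*s+y*t≈0 x y s≈0 t≈0 =
    trans (+-cong (trans (*-congˡ s≈0) (zeroʳ x)) (trans (*-congˡ t≈0) (zeroʳ y))) (+-identityˡ 0#)

  s+y*t≈0 : ∀ y {s t} → s ≈ 0# → t ≈ 0# → s + y * t ≈ 0#
  s+y*t≈0 y s≈0 t≈0 = trans (+-cong s≈0 (trans (*-congˡ t≈0) (zeroʳ y))) (+-identityˡ 0#)

  ax²+by²≈0∧x≈0⇒¬y≉0 : ∀ {a b x y} → b ≉ 0# → a * (x * x) + b * (y * y) ≈ 0# → x ≈ 0# →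
                         ¬ (y ≉ 0#)
  ax²+by²≈0∧x≈0⇒¬y≉0 {a} {b} {x} {y} b≉0 q≈0 x≈0 y≉0 = *-≉0 b≉0 (*-≉0 y≉0 y≉0) (begin
    b * (y * y)                 ≈⟨ +-identityˡ _ ⟨
    0# + b * (y * y)            ≈⟨ +-congʳ (trans (*-congˡ (trans (*-congʳ x≈0) (zeroˡ x))) (zeroʳ a)) ⟨
    a * (x * x) + b * (y * y)   ≈⟨ q≈0 ⟩
    0#                          ∎)

  NonSquare : Carrier → Set (c ⊔ ℓ)
  NonSquare x = ∀ s → s * s ≉ x

  NonSquare[-1]⇒1+1≉0 : NonSquare (- 1#) → 1# + 1# ≉ 0#
  NonSquare[-1]⇒1+1≉0 nsq 1+1≈0 = nsq 1# (trans (*-identityˡ 1#) (+-inverseˡ-unique 1# 1# 1+1≈0))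

  NonSquare-resp-≈ : ∀ {x y} → x ≈ y → NonSquare x → NonSquare y
  NonSquare-resp-≈ x≈y nsq s ss≈y = nsq s (trans ss≈y (sym x≈y))

  NonSquare-cancel-square : ∀ {x y} t → x ≈ (t * t) * y → NonSquare x → NonSquare y
  NonSquare-cancel-square {x} {y} t x≈tty nsq s ss≈y = nsq (t * s) (begin
    (t * s) * (t * s)   ≈⟨ solve 2 (λ t s → (t :* s) :* (t :* s) := (t :* t) :* (s :* s)) refl t s ⟩
    (t * t) * (s * s)   ≈⟨ *-congˡ ss≈y ⟩
    (t * t) * y         ≈⟨ x≈tty ⟨
    x                   ∎)

  ∑-linear : ∀ {n} (f : Fin n → Carrier) y g → Σᶠ F (λ i → f i + y * g i) ≈ Σᶠ F f + y * Σᶠ F g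
  ∑-linear f y g = trans (∑-distrib-+ f _) (+-congˡ (sym (*-distribˡ-sum y g)))

  ∑-weighted-linear : ∀ {m} (cs f g : Fin m → Carrier) x y →
                      Σᶠ F (λ j → cs j * (x * f j + y * g j))
                      ≈ x * Σᶠ F (λ j → cs j * f j) + y * Σᶠ F (λ j → cs j * g j)
  ∑-weighted-linear cs f g x y = begin
    Σᶠ F (λ j → cs j * (x * f j + y * g j))
      ≈⟨ sum-cong-≋ (λ j → solve 5 (λ c x f y g → c :* (x :* f :+ y :* g) := x :* (c :* f) :+ y :* (c :* g))
                                    refl (cs j) x (f j) y (g j)) ⟩
    Σᶠ F (λ j → x * (cs j * f j) + y * (cs j * g j))
      ≈⟨ ∑-distrib-+ (λ j → x * (cs j * f j)) _ ⟩
    Σᶠ F (λ j → x * (cs j * f j)) + Σᶠ F (λ j → y * (cs j * g j))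
      ≈⟨ +-cong (*-distribˡ-sum x (λ j → cs j * f j)) (*-distribˡ-sum y (λ j → cs j * g j)) ⟨
    x * Σᶠ F (λ j → cs j * f j) + y * Σᶠ F (λ j → cs j * g j)
      ∎

  -- Diagonal forms

  -- ⟨_,_⟩ F {d} is definitionally diagForm (sign F d).
  diagForm : ∀ {n} → (Fin n → Carrier) → Vec F n → Vec F n → Carrier
  diagForm a u v = Σᶠ F (λ i → a i * (u i * v i))

  module _ {n} (a : Fin n → Carrier) where

    diagForm-cong : ∀ {u u′ v v′ : Vec F n} → (∀ i → u i ≈ u′ i) → (∀ i → v i ≈ v′ i) →
                    diagForm a u v ≈ diagForm a u′ v′
    diagForm-cong u≈u′ v≈v′ = sum-cong-≋ λ i → *-congˡ (*-cong (u≈u′ i) (v≈v′ i))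

    diagForm-sym : ∀ u v → diagForm a u v ≈ diagForm a v u
    diagForm-sym u v = sum-cong-≋ λ i → *-congˡ (*-comm (u i) (v i))

    diagForm-zeroˡ : ∀ {u} v → (∀ i → u i ≈ 0#) → diagForm a u v ≈ 0#
    diagForm-zeroˡ v u≈0 = sum-≈ε λ i →
      trans (*-congˡ (trans (*-congʳ (u≈0 i)) (zeroˡ (v i)))) (zeroʳ (a i))

    diagForm-linearˡ : ∀ u y v w → diagForm a (λ i → u i + y * v i) w ≈ diagForm a u w + y * diagForm a v w
    diagForm-linearˡ u y v w = begin
      Σᶠ F (λ i → a i * ((u i + y * v i) * w i))
        ≈⟨ sum-cong-≋ (λ i → expand (a i) (u i) (v i) (w i)) ⟩
      Σᶠ F (λ i → a i * (u i * w i) + y * (a i * (v i * w i)))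
        ≈⟨ ∑-linear (λ i → a i * (u i * w i)) y (λ i → a i * (v i * w i)) ⟩
      diagForm a u w + y * diagForm a v w
        ∎
      where
      expand : ∀ aᵢ uᵢ vᵢ wᵢ →
               aᵢ * ((uᵢ + y * vᵢ) * wᵢ) ≈ aᵢ * (uᵢ * wᵢ) + y * (aᵢ * (vᵢ * wᵢ))
      expand aᵢ uᵢ vᵢ wᵢ = solve 5 (λ aᵢ uᵢ vᵢ wᵢ y → aᵢ :* ((uᵢ :+ y :* vᵢ) :* wᵢ)
                                                     := aᵢ :* (uᵢ :* wᵢ) :+ y :* (aᵢ :* (vᵢ :* wᵢ)))
                                   refl aᵢ uᵢ vᵢ wᵢ y

    diagForm-linearʳ : ∀ w u y v → diagForm a w (λ i → u i + y * v i) ≈ diagForm a w u + y * diagForm a w v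
    diagForm-linearʳ w u y v = begin
      diagForm a w (λ i → u i + y * v i)    ≈⟨ diagForm-sym w _ ⟩
      diagForm a (λ i → u i + y * v i) w    ≈⟨ diagForm-linearˡ u y v w ⟩
      diagForm a u w + y * diagForm a v w   ≈⟨ +-cong (diagForm-sym u w) (*-congˡ (diagForm-sym v w)) ⟩
      diagForm a w u + y * diagForm a w v   ∎

  diagForm-tail : ∀ {n} (a : Fin (suc n) → Carrier) {u : Vec F (suc n)} w → u zero ≈ 0# →
                  diagForm a u w ≈ diagForm (tail a) (tail u) (tail w)
  diagForm-tail a w u₀≈0 =
    trans (+-congʳ (trans (*-congˡ (trans (*-congʳ u₀≈0) (zeroˡ (w zero)))) (zeroʳ (a zero)))) (+-identityˡ _)

  unit : ∀ {m} → Fin m → Fin m → Carrier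
  unit j = updateAt (const 0#) j (const 1#)

  lincomb-unit : ∀ {m n} (l : Fin m → Vec F n) j i → lincomb F (unit j) l i ≈ l j i
  lincomb-unit l j i = begin
    lincomb F (unit j) l i   ≈⟨ sum-≈ε-off j (λ j′ j′≢j →
                                  trans (*-congʳ (reflexive (updateAt-minimal j′ j _ j′≢j))) (zeroˡ _)) ⟩
    unit j j * l j i         ≡⟨ ≡.cong (_* l j i) (updateAt-updates j _) ⟩
    1# * l j i               ≈⟨ *-identityˡ (l j i) ⟩
    l j i                    ∎

  independent⇒nonzero : ∀ {m n} {l : Fin m → Vec F n} → LinearlyIndependent F l →
                        ∀ j → ¬ (∀ i → l j i ≈ 0#)
  independent⇒nonzero {l = l} ind j lⱼ≈0 = 1≉0 (trans (reflexive (≡.sym (updateAt-updates j _)))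
    (ind (unit j) (λ i → trans (lincomb-unit l j i) (lⱼ≈0 i)) j))

  independent-tail : ∀ {m n} {u : Fin m → Vec F (suc n)} → (∀ j → u j zero ≈ 0#) →
                     LinearlyIndependent F u → LinearlyIndependent F (tail ∘ u)
  independent-tail u₀≈0 ind cs Σ≈0 = ind cs λ where
    zero    → sum-≈ε λ j → trans (*-congˡ (u₀≈0 j)) (zeroʳ (cs j))
    (suc i) → Σ≈0 i

  independent-shear : ∀ {m n} {l : Fin (suc m) → Vec F n} → LinearlyIndependent F l →
                      (γ : Fin m → Carrier) → LinearlyIndependent F (λ j i → l (suc j) i + γ j * l zero i)
  independent-shear {l = l} ind γ cs Σ≈0 j =
    ind (Σᶠ F (λ j → cs j * γ j) ∷ cs) (λ i → trans (unshear i) (Σ≈0 i)) (suc j)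
    where
    unshear : ∀ i → lincomb F (Σᶠ F (λ j → cs j * γ j) ∷ cs) l i
                    ≈ lincomb F cs (λ j i → l (suc j) i + γ j * l zero i) i
    unshear i = begin
      Σᶠ F (λ j → cs j * γ j) * l zero i + Σᶠ F (λ j → cs j * l (suc j) i)
        ≈⟨ +-comm _ _ ⟩
      Σᶠ F (λ j → cs j * l (suc j) i) + Σᶠ F (λ j → cs j * γ j) * l zero i
        ≈⟨ +-congˡ (*-distribʳ-sum (l zero i) (λ j → cs j * γ j)) ⟩
      Σᶠ F (λ j → cs j * l (suc j) i) + Σᶠ F (λ j → cs j * γ j * l zero i)
        ≈⟨ ∑-distrib-+ (λ j → cs j * l (suc j) i) _ ⟨
      Σᶠ F (λ j → cs j * l (suc j) i + cs j * γ j * l zero i)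
        ≈⟨ sum-cong-≋ (λ j → solve 4 (λ c x g y → c :* x :+ c :* g :* y := c :* (x :+ g :* y))
                                      refl (cs j) (l (suc j) i) (γ j) (l zero i)) ⟩
      lincomb F cs (λ j i → l (suc j) i + γ j * l zero i) i
        ∎

  record Isometry {n} (a a′ : Fin n → Carrier) : Set (c ⊔ ℓ) where
    field
      map       : Vec F n → Vec F n
      linear    : ∀ {m} cs (l : Fin m → Vec F n) i → lincomb F cs (map ∘ l) i ≈ map (lincomb F cs l) i
      injective : ∀ x → (∀ i → map x i ≈ 0#) → ∀ i → x i ≈ 0#
      isometric : ∀ x y → diagForm a′ (map x) (map y) ≈ diagForm a x y

    map-independent : ∀ {m} {l : Fin m → Vec F n} → LinearlyIndependent F l → LinearlyIndependent F (map ∘ l)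
    map-independent {l = l} ind cs Σ≈0 = ind cs (injective _ λ i → trans (sym (linear cs l i)) (Σ≈0 i))

  -- With ν = a_p α² + a_q β² invertible, (x_p, x_q) ↦ (a_p α x_p + a_q β x_q , α x_q − β x_p) carries
  -- a_p x_p² + a_q x_q² to ν⁻¹ y_p² + a_p a_q ν⁻¹ y_q², and sends (α, β) to (ν, 0).
  module Givens {n} (a : Fin n → Carrier) {p q : Fin n} (p≢q : p ≢ q) (α β : Carrier) {ν⁻¹ : Carrier}
                (ν*ν⁻¹≈1 : (a p * (α * α) + a q * (β * β)) * ν⁻¹ ≈ 1#) where

    ν : Carrier
    ν = a p * (α * α) + a q * (β * β)

    rot₁ rot₂ : Vec F n → Carrier
    rot₁ x = (a p * α) * x p + (a q * β) * x q
    rot₂ x = α * x q + (- β) * x p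

    rotate : Vec F n → Vec F n
    rotate x = update₂ x p (rot₁ x) q (rot₂ x)

    a′ : Fin n → Carrier
    a′ = update₂ a p ν⁻¹ q (a p * a q * ν⁻¹)

    ν≉0 : ν ≉ 0#
    ν≉0 = x*y≈1⇒x≉0 ν*ν⁻¹≈1

    rotate-kills : ∀ x → x p ≈ α → x q ≈ β → rotate x q ≈ 0#
    rotate-kills x xₚ≈α x_q≈β = begin
      rotate x q              ≡⟨ update₂-second x p≢q ⟩
      α * x q + (- β) * x p   ≈⟨ +-cong (*-congˡ x_q≈β) (*-congˡ xₚ≈α) ⟩
      α * β + (- β) * α       ≈⟨ solve 2 (λ α β → α :* β :+ (:- β) :* α := con (+ 0)) refl α β ⟩
      0#                      ∎

    a′≉0 : (∀ i → a i ≉ 0#) → ∀ i → a′ i ≉ 0#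
    a′≉0 a≉0 i with i ≟ p | i ≟ q
    ... | yes ≡.refl | _          = ≡.subst (_≉ 0#) (≡.sym (update₂-first a)) (x*y≈1⇒y≉0 ν*ν⁻¹≈1)
    ... | no _       | yes ≡.refl = ≡.subst (_≉ 0#) (≡.sym (update₂-second a p≢q))
                                      (*-≉0 (*-≉0 (a≉0 p) (a≉0 q)) (x*y≈1⇒y≉0 ν*ν⁻¹≈1))
    ... | no i≢p     | no i≢q     = ≡.subst (_≉ 0#) (≡.sym (update₂-minimal a i i≢p i≢q)) (a≉0 i)

    ∏-a′ : ∏ a ≈ (ν * ν) * ∏ a′
    ∏-a′ = trans (sym (*-identityˡ (∏ a)))
      (∏.sum-cong-off₂ p≢q (λ i i≢p i≢q → reflexive (≡.sym (update₂-minimal a i i≢p i≢q))) (begin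
        1# * (a p * a q)                        ≈⟨ *-congʳ (*-identityˡ 1#) ⟨
        (1# * 1#) * (a p * a q)                 ≈⟨ *-congʳ (*-cong ν*ν⁻¹≈1 ν*ν⁻¹≈1) ⟨
        ((ν * ν⁻¹) * (ν * ν⁻¹)) * (a p * a q)   ≈⟨ solve 4 (λ ν ν⁻¹ aₚ a_q →
                                                      ((ν :* ν⁻¹) :* (ν :* ν⁻¹)) :* (aₚ :* a_q)
                                                      := (ν :* ν) :* (ν⁻¹ :* (aₚ :* a_q :* ν⁻¹)))
                                                    refl ν ν⁻¹ (a p) (a q) ⟩
        (ν * ν) * (ν⁻¹ * (a p * a q * ν⁻¹))     ≡⟨ ≡.cong₂ (λ x y → (ν * ν) * (x * y))
                                                            (update₂-first a) (update₂-second a p≢q) ⟨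
        (ν * ν) * (a′ p * a′ q)                 ∎))

    isometry : Isometry a a′
    isometry = record { map = rotate ; linear = linear ; injective = injective ; isometric = isometric }
      where
      linear : ∀ {m} cs (l : Fin m → Vec F n) i → lincomb F cs (rotate ∘ l) i ≈ rotate (lincomb F cs l) i
      linear cs l i with i ≟ p | i ≟ q
      ... | yes ≡.refl | _ = begin
        Σᶠ F (λ j → cs j * rotate (l j) p)
          ≈⟨ sum-cong-≋ (λ j → reflexive (≡.cong (cs j *_) (update₂-first (l j)))) ⟩
        Σᶠ F (λ j → cs j * rot₁ (l j))
          ≈⟨ ∑-weighted-linear cs (λ j → l j p) (λ j → l j q) (a p * α) (a q * β) ⟩
        rot₁ (lincomb F cs l)
          ≡⟨ update₂-first (lincomb F cs l) ⟨
        rotate (lincomb F cs l) p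
          ∎
      ... | no _ | yes ≡.refl = begin
        Σᶠ F (λ j → cs j * rotate (l j) q)
          ≈⟨ sum-cong-≋ (λ j → reflexive (≡.cong (cs j *_) (update₂-second (l j) p≢q))) ⟩
        Σᶠ F (λ j → cs j * rot₂ (l j))
          ≈⟨ ∑-weighted-linear cs (λ j → l j q) (λ j → l j p) α (- β) ⟩
        rot₂ (lincomb F cs l)
          ≡⟨ update₂-second (lincomb F cs l) p≢q ⟨
        rotate (lincomb F cs l) q
          ∎
      ... | no i≢p | no i≢q = begin
        Σᶠ F (λ j → cs j * rotate (l j) i)
          ≈⟨ sum-cong-≋ (λ j → reflexive (≡.cong (cs j *_) (update₂-minimal (l j) i i≢p i≢q))) ⟩
        lincomb F cs l i
          ≡⟨ update₂-minimal (lincomb F cs l) i i≢p i≢q ⟨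
        rotate (lincomb F cs l) i
          ∎

      rot₁≈0 : ∀ x → (∀ i → rotate x i ≈ 0#) → rot₁ x ≈ 0#
      rot₁≈0 x rotate≈0 = trans (reflexive (≡.sym (update₂-first x))) (rotate≈0 p)

      rot₂≈0 : ∀ x → (∀ i → rotate x i ≈ 0#) → rot₂ x ≈ 0#
      rot₂≈0 x rotate≈0 = trans (reflexive (≡.sym (update₂-second x p≢q))) (rotate≈0 q)

      injective : ∀ x → (∀ i → rotate x i ≈ 0#) → ∀ i → x i ≈ 0#
      injective x rotate≈0 i with i ≟ p | i ≟ q
      ... | yes ≡.refl | _ = x≉0∧x*y≈0⇒y≈0 ν≉0 (begin
        ν * x p
          ≈⟨ solve 6 (λ aₚ a_q α β xₚ x_q → (aₚ :* (α :* α) :+ a_q :* (β :* β)) :* xₚ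
                                         := α :* ((aₚ :* α) :* xₚ :+ (a_q :* β) :* x_q)
                                            :+ (:- (a_q :* β)) :* (α :* x_q :+ (:- β) :* xₚ))
                     refl (a p) (a q) α β (x p) (x q) ⟩
        α * rot₁ x + (- (a q * β)) * rot₂ x
          ≈⟨ x*s+y*t≈0 α (- (a q * β)) (rot₁≈0 x rotate≈0) (rot₂≈0 x rotate≈0) ⟩
        0#
          ∎)
      ... | no _ | yes ≡.refl = x≉0∧x*y≈0⇒y≈0 ν≉0 (begin
        ν * x q
          ≈⟨ solve 6 (λ aₚ a_q α β xₚ x_q → (aₚ :* (α :* α) :+ a_q :* (β :* β)) :* x_q
                                         := β :* ((aₚ :* α) :* xₚ :+ (a_q :* β) :* x_q)
                                            :+ (aₚ :* α) :* (α :* x_q :+ (:- β) :* xₚ))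
                     refl (a p) (a q) α β (x p) (x q) ⟩
        β * rot₁ x + (a p * α) * rot₂ x
          ≈⟨ x*s+y*t≈0 β (a p * α) (rot₁≈0 x rotate≈0) (rot₂≈0 x rotate≈0) ⟩
        0#
          ∎)
      ... | no i≢p | no i≢q = trans (reflexive (≡.sym (update₂-minimal x i i≢p i≢q))) (rotate≈0 i)

      isometric : ∀ x y → diagForm a′ (rotate x) (rotate y) ≈ diagForm a x y
      isometric x y = begin
        diagForm a′ (rotate x) (rotate y)        ≈⟨ +-identityˡ _ ⟨
        0# + diagForm a′ (rotate x) (rotate y)   ≈⟨ sum-cong-off₂ p≢q unchanged (+-congˡ on-plane) ⟩
        0# + diagForm a x y                      ≈⟨ +-identityˡ _ ⟩
        diagForm a x y                           ∎
        where
        unchanged : ∀ i → i ≢ p → i ≢ q → a′ i * (rotate x i * rotate y i) ≈ a i * (x i * y i)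
        unchanged i i≢p i≢q = reflexive (≡.cong₂ _*_ (update₂-minimal a i i≢p i≢q)
          (≡.cong₂ _*_ (update₂-minimal x i i≢p i≢q) (update₂-minimal y i i≢p i≢q)))

        on-plane : a′ p * (rotate x p * rotate y p) + a′ q * (rotate x q * rotate y q)
                   ≈ a p * (x p * y p) + a q * (x q * y q)
        on-plane = begin
          a′ p * (rotate x p * rotate y p) + a′ q * (rotate x q * rotate y q)
            ≡⟨ ≡.cong₂ _+_
                 (≡.cong₂ _*_ (update₂-first a) (≡.cong₂ _*_ (update₂-first x) (update₂-first y)))
                 (≡.cong₂ _*_ (update₂-second a p≢q)
                              (≡.cong₂ _*_ (update₂-second x p≢q) (update₂-second y p≢q))) ⟩
          ν⁻¹ * (rot₁ x * rot₁ y) + (a p * a q * ν⁻¹) * (rot₂ x * rot₂ y)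
            ≈⟨ solve 9 (λ ν⁻¹ aₚ a_q α β xₚ x_q yₚ y_q →
                 ν⁻¹ :* (((aₚ :* α) :* xₚ :+ (a_q :* β) :* x_q) :* ((aₚ :* α) :* yₚ :+ (a_q :* β) :* y_q))
                 :+ (aₚ :* a_q :* ν⁻¹) :* ((α :* x_q :+ (:- β) :* xₚ) :* (α :* y_q :+ (:- β) :* yₚ))
                 := ((aₚ :* (α :* α) :+ a_q :* (β :* β)) :* ν⁻¹)
                    :* (aₚ :* (xₚ :* yₚ) :+ a_q :* (x_q :* y_q)))
                 refl ν⁻¹ (a p) (a q) α β (x p) (x q) (y p) (y q) ⟩
          (ν * ν⁻¹) * (a p * (x p * y p) + a q * (x q * y q))
            ≈⟨ trans (*-congʳ ν*ν⁻¹≈1) (*-identityˡ _) ⟩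
          a p * (x p * y p) + a q * (x q * y q)
            ∎

  -- Hyperbolic diagonal forms have square discriminant

  -- Data refuting "a nondegenerate diagonal form in 2m variables with an m-dimensional totally isotropic
  -- subspace has square discriminant (−1)^m·det", with the number n of variables left free.
  record Counterexample (m n : ℕ) : Set (c ⊔ ℓ) where
    field
      coeff       : Fin n → Carrier
      coeff≉0     : ∀ i → coeff i ≉ 0#
      basis       : Fin m → Vec F n
      independent : LinearlyIndependent F basis
      isotropic   : ∀ i j → diagForm coeff (basis i) (basis j) ≈ 0#
      nonsquare   : NonSquare ((- 1#) ^ m * ∏ coeff)

  open Counterexample

  lead : ∀ {m n} → Counterexample (suc m) n → Vec F n
  lead X = basis X zero

  pairNorm : ∀ {m n} → Counterexample (suc m) n → Fin n → Fin n → Carrier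
  pairNorm X p q = coeff X p * (lead X p * lead X p) + coeff X q * (lead X q * lead X q)

  rotate-pair : ∀ {m n} (X : Counterexample (suc m) n) {p q} → p ≢ q → pairNorm X p q ≉ 0# →
                Σ (Counterexample (suc m) n) λ X′ → lead X′ q ≈ 0# ×
                  (∀ i → i ≢ p → i ≢ q → lead X′ i ≡ lead X i × coeff X′ i ≡ coeff X i)
  rotate-pair {m} X {p} {q} p≢q ν≉0 with inverse (pairNorm X p q) ν≉0
  ... | ν⁻¹ , ν*ν⁻¹≈1 = X′ , rotate-kills (lead X) refl refl , unchanged
    where
    open Givens (coeff X) p≢q (lead X p) (lead X q) ν*ν⁻¹≈1
    open Isometry isometry using (map-independent; isometric)

    X′ : Counterexample (suc m) _
    X′ = record
      { coeff       = a′
      ; coeff≉0     = a′≉0 (coeff≉0 X)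
      ; basis       = rotate ∘ basis X
      ; independent = map-independent {l = basis X} (independent X)
      ; isotropic   = λ i j → trans (isometric _ _) (isotropic X i j)
      ; nonsquare   = NonSquare-cancel-square ν (begin
          s * ∏ (coeff X)        ≈⟨ *-congˡ ∏-a′ ⟩
          s * ((ν * ν) * ∏ a′)   ≈⟨ x∙yz≈y∙xz s (ν * ν) (∏ a′) ⟩
          (ν * ν) * (s * ∏ a′)   ∎) (nonsquare X)
      }
      where
      s : Carrier
      s = (- 1#) ^ suc m

    unchanged : ∀ i → i ≢ p → i ≢ q → rotate (lead X) i ≡ lead X i × a′ i ≡ coeff X i
    unchanged i i≢p i≢q = update₂-minimal (lead X) i i≢p i≢q , update₂-minimal (coeff X) i i≢p i≢q

  -- The lead vector v = (α, β, 0, …, 0) is isotropic, so −a₀a₁ = (a₁β/α)².  Subtracting multiples of v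
  -- clears the first coordinate of the other basis vectors; orthogonality to v then clears the second.
  module SplitHyperbolicPlane {m N} (X : Counterexample (suc m) (suc (suc N)))
                              (concentrated : ∀ i → lead X (suc (suc i)) ≈ 0#) where

    a : Fin (suc (suc N)) → Carrier
    a = coeff X

    v : Vec F (suc (suc N))
    v = lead X

    a₀ a₁ α β : Carrier
    a₀ = a zero
    a₁ = a (suc zero)
    α = v zero
    β = v (suc zero)

    form-with-v : ∀ w → diagForm a v w ≈ a₀ * (α * w zero) + a₁ * (β * w (suc zero))
    form-with-v w =
      +-congˡ (trans (+-congˡ (diagForm-zeroˡ (tail (tail a)) (tail (tail w)) concentrated)) (+-identityʳ _))

    v-isotropic : a₀ * (α * α) + a₁ * (β * β) ≈ 0#
    v-isotropic = trans (sym (form-with-v v)) (isotropic X zero zero)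

    α≉0 : α ≉ 0#
    α≉0 α≈0 = ¬¬-excluded-middle {A = β ≈ 0#} λ where
      (yes β≈0) → independent⇒nonzero {l = basis X} (independent X) zero λ where
        zero          → α≈0
        (suc zero)    → β≈0
        (suc (suc i)) → concentrated i
      (no β≉0)  → ax²+by²≈0∧x≈0⇒¬y≉0 (coeff≉0 X (suc zero)) v-isotropic α≈0 β≉0

    β≉0 : β ≉ 0#
    β≉0 β≈0 = ax²+by²≈0∧x≈0⇒¬y≉0 (coeff≉0 X zero) (trans (+-comm _ _) v-isotropic) β≈0 α≉0

    α⁻¹ : Carrier
    α⁻¹ = proj₁ (inverse α α≉0)

    α*α⁻¹≈1 : α * α⁻¹ ≈ 1#
    α*α⁻¹≈1 = proj₂ (inverse α α≉0)

    t : Carrier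
    t = a₁ * β * α⁻¹

    t*t≈-a₀a₁ : t * t ≈ - (a₀ * a₁)
    t*t≈-a₀a₁ = begin
      t * t
        ≈⟨ solve 5 (λ a₀ a₁ α β α⁻¹ → (a₁ :* β :* α⁻¹) :* (a₁ :* β :* α⁻¹)
                                      := (a₁ :* α⁻¹ :* α⁻¹) :* (a₀ :* (α :* α) :+ a₁ :* (β :* β))
                                         :+ (:- (a₀ :* a₁)) :* ((α :* α⁻¹) :* (α :* α⁻¹)))
                   refl a₀ a₁ α β α⁻¹ ⟩
      (a₁ * α⁻¹ * α⁻¹) * (a₀ * (α * α) + a₁ * (β * β))
        + (- (a₀ * a₁)) * ((α * α⁻¹) * (α * α⁻¹))
        ≈⟨ +-cong (trans (*-congˡ v-isotropic) (zeroʳ _))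
                  (*-congˡ (trans (*-cong α*α⁻¹≈1 α*α⁻¹≈1) (*-identityˡ 1#))) ⟩
      0# + (- (a₀ * a₁)) * 1#
        ≈⟨ trans (+-identityˡ _) (*-identityʳ _) ⟩
      - (a₀ * a₁)
        ∎

    γ : Fin m → Carrier
    γ j = - (basis X (suc j) zero * α⁻¹)

    u : Fin m → Vec F (suc (suc N))
    u j i = basis X (suc j) i + γ j * v i

    u₀≈0 : ∀ j → u j zero ≈ 0#
    u₀≈0 j = begin
      x + (- (x * α⁻¹)) * α   ≈⟨ +-congˡ (solve 3 (λ x α α⁻¹ → (:- (x :* α⁻¹)) :* α
                                                               := :- (x :* (α :* α⁻¹))) refl x α α⁻¹) ⟩
      x + - (x * (α * α⁻¹))   ≈⟨ +-congˡ (-‿cong (trans (*-congˡ α*α⁻¹≈1) (*-identityʳ x))) ⟩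
      x + - x                 ≈⟨ -‿inverseʳ x ⟩
      0#                      ∎
      where
      x : Carrier
      x = basis X (suc j) zero

    ⊥u : ∀ w j → diagForm a w (basis X (suc j)) ≈ 0# → diagForm a w v ≈ 0# → diagForm a w (u j) ≈ 0#
    ⊥u w j w⊥lⱼ w⊥v = trans (diagForm-linearʳ a w (basis X (suc j)) (γ j) v) (s+y*t≈0 (γ j) w⊥lⱼ w⊥v)

    u-isotropic : ∀ i j → diagForm a (u i) (u j) ≈ 0#
    u-isotropic i j = trans (diagForm-linearˡ a (basis X (suc i)) (γ i) v (u j))
      (s+y*t≈0 (γ i) (⊥u (basis X (suc i)) j (isotropic X (suc i) (suc j)) (isotropic X (suc i) zero))
                     (⊥u v j (isotropic X zero (suc j)) (isotropic X zero zero)))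

    u₁≈0 : ∀ j → u j (suc zero) ≈ 0#
    u₁≈0 j = x≉0∧x*y≈0⇒y≈0 β≉0 (x≉0∧x*y≈0⇒y≈0 (coeff≉0 X (suc zero)) (begin
      a₁ * (β * u j (suc zero))
        ≈⟨ +-identityˡ _ ⟨
      0# + a₁ * (β * u j (suc zero))
        ≈⟨ +-congʳ (trans (*-congˡ (trans (*-congˡ (u₀≈0 j)) (zeroʳ α))) (zeroʳ a₀)) ⟨
      a₀ * (α * u j zero) + a₁ * (β * u j (suc zero))
        ≈⟨ form-with-v (u j) ⟨
      diagForm a v (u j)
        ≈⟨ ⊥u v j (isotropic X zero (suc j)) (isotropic X zero zero) ⟩
      0#
        ∎))

    reduced : Counterexample m N
    reduced = record
      { coeff       = tail (tail a)
      ; coeff≉0     = λ i → coeff≉0 X (suc (suc i))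
      ; basis       = λ j → tail (tail (u j))
      ; independent = independent-tail {u = tail ∘ u} u₁≈0
                        (independent-tail {u = u} u₀≈0 (independent-shear {l = basis X} (independent X) γ))
      ; isotropic   = λ i j → begin
          diagForm (tail (tail a)) (tail (tail (u i))) (tail (tail (u j)))
            ≈⟨ diagForm-tail (tail a) {tail (u i)} (tail (u j)) (u₁≈0 i) ⟨
          diagForm (tail a) (tail (u i)) (tail (u j))
            ≈⟨ diagForm-tail a {u i} (u j) (u₀≈0 i) ⟨
          diagForm a (u i) (u j)
            ≈⟨ u-isotropic i j ⟩
          0#
            ∎
      ; nonsquare   = NonSquare-cancel-square t (begin
          (- 1# * s) * (a₀ * (a₁ * P))   ≈⟨ *-congʳ (-1*x≈-x s) ⟩
          (- s) * (a₀ * (a₁ * P))        ≈⟨ solve 4 (λ s a₀ a₁ P → (:- s) :* (a₀ :* (a₁ :* P))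
                                                                   := (:- (a₀ :* a₁)) :* (s :* P))
                                                    refl s a₀ a₁ P ⟩
          (- (a₀ * a₁)) * (s * P)        ≈⟨ *-congʳ t*t≈-a₀a₁ ⟨
          (t * t) * (s * P)              ∎) (nonsquare X)
      }
      where
      s P : Carrier
      s = (- 1#) ^ m
      P = ∏ (tail (tail a))

  module Char≢2 (1+1≉0 : 1# + 1# ≉ 0#) where

    x+x≈0⇒x≈0 : ∀ {x} → x + x ≈ 0# → x ≈ 0#
    x+x≈0⇒x≈0 {x} x+x≈0 =
      x≉0∧x*y≈0⇒y≈0 1+1≉0
        (trans (distribʳ x 1# 1#) (trans (+-cong (*-identityˡ x) (*-identityˡ x)) x+x≈0))

    ClearedAt : ∀ {m N} → Fin N → (X X′ : Counterexample (suc m) (suc (suc N))) → Set (c ⊔ ℓ)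
    ClearedAt j X X′ = lead X′ (suc (suc j)) ≈ 0# ×
                       (∀ i → i ≢ j → lead X′ (suc (suc i)) ≡ lead X (suc (suc i)))

    -- Rotate in the plane (1, J) or (0, J).  If both are isotropic for v while v_J ≠ 0, the plane (0, 1)
    -- is not (its norm is −2 a_J v_J²), and rotating it first makes (1, J) anisotropic.
    clear-coordinate : ∀ {m N} (X : Counterexample (suc m) (suc (suc N))) j → ¬ ¬ ∃ (ClearedAt j X)
    clear-coordinate {N = N} X j k =
      ¬¬-excluded-middle {A = v J ≈ 0#} λ where
        (yes vⱼ≈0) → k (X , vⱼ≈0 , λ _ _ → ≡.refl)
        (no vⱼ≉0)  → ¬¬-excluded-middle {A = pairNorm X (suc zero) J ≈ 0#} λ where
          (no ν₁≉0)  → k (rotate-into (suc zero) (λ _ ()) ν₁≉0)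
          (yes ν₁≈0) → ¬¬-excluded-middle {A = pairNorm X zero J ≈ 0#} λ where
            (no ν₀≉0)  → k (rotate-into zero (λ _ ()) ν₀≉0)
            (yes ν₀≈0) → k (rotate-twice vⱼ≉0 ν₀≈0 ν₁≈0)
      where
      J : Fin (suc (suc N))
      J = suc (suc j)
      v : Vec F (suc (suc N))
      v = lead X

      a : Fin (suc (suc N)) → Carrier
      a = coeff X

      rotate-into : ∀ p → (∀ i → suc (suc i) ≢ p) → pairNorm X p J ≉ 0# → ∃ (ClearedAt j X)
      rotate-into p off ν≉0 =
        let (X′ , cleared , unchanged) = rotate-pair X (off j ∘ ≡.sym) ν≉0
        in X′ , cleared , λ i i≢j →
             proj₁ (unchanged (suc (suc i)) (off i) (i≢j ∘ suc-injective ∘ suc-injective))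

      rotate-twice : v J ≉ 0# → pairNorm X zero J ≈ 0# → pairNorm X (suc zero) J ≈ 0# → ∃ (ClearedAt j X)
      rotate-twice vⱼ≉0 ν₀≈0 ν₁≈0 =
        let (X₁ , v₁≈0 , unchanged₁) = rotate-pair X {zero} {suc zero} (λ ()) ν₀₁≉0
            (X₂ , cleared , unchanged₂) =
              rotate-pair X₁ {suc zero} {J} (λ ()) (ν₁≉0 X₁ v₁≈0 (unchanged₁ J (λ ()) (λ ())))
        in X₂ , cleared , λ i i≢j →
             ≡.trans (proj₁ (unchanged₂ (suc (suc i)) (λ ()) (i≢j ∘ suc-injective ∘ suc-injective)))
                     (proj₁ (unchanged₁ (suc (suc i)) (λ ()) (λ ())))
        where
        w : Carrier
        w = a J * (v J * v J)

        w≉0 : w ≉ 0#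
        w≉0 = *-≉0 (coeff≉0 X J) (*-≉0 vⱼ≉0 vⱼ≉0)

        ν₀₁≉0 : pairNorm X zero (suc zero) ≉ 0#
        ν₀₁≉0 ν₀₁≈0 = w≉0 (x+x≈0⇒x≈0 (begin
          w + w
            ≈⟨ +-identityˡ _ ⟨
          0# + (w + w)
            ≈⟨ +-congʳ ν₀₁≈0 ⟨
          pairNorm X zero (suc zero) + (w + w)
            ≈⟨ solve 3 (λ x y w → (x :+ y) :+ (w :+ w) := (x :+ w) :+ (y :+ w))
                       refl (a zero * (v zero * v zero)) (a (suc zero) * (v (suc zero) * v (suc zero))) w ⟩
          pairNorm X zero J + pairNorm X (suc zero) J
            ≈⟨ trans (+-cong ν₀≈0 ν₁≈0) (+-identityˡ 0#) ⟩
          0#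
            ∎))

        ν₁≉0 : ∀ X₁ → lead X₁ (suc zero) ≈ 0# → lead X₁ J ≡ v J × coeff X₁ J ≡ a J →
               pairNorm X₁ (suc zero) J ≉ 0#
        ν₁≉0 X₁ v₁≈0 (vⱼ-same , aⱼ-same) ν≈0 = w≉0 (begin
          w                          ≈⟨ +-identityˡ w ⟨
          0# + w                     ≈⟨ +-cong (trans (*-congˡ (trans (*-congʳ v₁≈0) (zeroˡ _))) (zeroʳ _))
                                               (reflexive (≡.cong₂ (λ x y → x * (y * y)) aⱼ-same vⱼ-same)) ⟨
          pairNorm X₁ (suc zero) J   ≈⟨ ν≈0 ⟩
          0#                         ∎)

    concentrate : ∀ {m N} (X : Counterexample (suc m) (suc (suc N))) →
                  ¬ ¬ (∃ λ X′ → ∀ i → lead X′ (suc (suc i)) ≈ 0#)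
    concentrate = ¬¬-establish-∀ (λ i X → lead X (suc (suc i)) ≈ 0#) λ i X k →
      clear-coordinate X i λ (X′ , cleared , unchanged) →
      k (X′ , cleared , λ j j≢i vⱼ≈0 → trans (reflexive (unchanged j j≢i)) vⱼ≈0)

    no-counterexample : ∀ m → ¬ Counterexample m (double m)
    no-counterexample zero    X = nonsquare X 1# refl
    no-counterexample (suc m) X = concentrate X λ (X′ , concentrated) →
      no-counterexample m (SplitHyperbolicPlane.reduced X′ concentrated)

    polarization : ∀ {n} (a : Fin n → Carrier) {u v : Vec F n} →
                   diagForm a u u ≈ 0# → diagForm a v v ≈ 0# →
                   diagForm a (λ i → u i + v i) (λ i → u i + v i) ≈ 0# → diagForm a u v ≈ 0#
    polarization a {u} {v} Qu≈0 Qv≈0 Q[u+v]≈0 = x+x≈0⇒x≈0 (begin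
      B + B
        ≈⟨ +-identityˡ _ ⟨
      0# + (B + B)
        ≈⟨ +-congʳ (trans (+-cong Qu≈0 Qv≈0) (+-identityˡ 0#)) ⟨
      (diagForm a u u + diagForm a v v) + (B + B)
        ≈⟨ +-cong (∑-distrib-+ (λ i → a i * (u i * u i)) _) (∑-distrib-+ (λ i → a i * (u i * v i)) _) ⟨
      Σᶠ F (λ i → a i * (u i * u i) + a i * (v i * v i)) + Σᶠ F (λ i → a i * (u i * v i) + a i * (u i * v i))
        ≈⟨ ∑-distrib-+ (λ i → a i * (u i * u i) + a i * (v i * v i)) _ ⟨
      Σᶠ F (λ i → (a i * (u i * u i) + a i * (v i * v i)) + (a i * (u i * v i) + a i * (u i * v i)))
        ≈⟨ sum-cong-≋ (λ i → expand (a i) (u i) (v i)) ⟩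
      diagForm a (λ i → u i + v i) (λ i → u i + v i)
        ≈⟨ Q[u+v]≈0 ⟩
      0#
        ∎)
      where
      B : Carrier
      B = diagForm a u v
      expand : ∀ aᵢ uᵢ vᵢ →
               (aᵢ * (uᵢ * uᵢ) + aᵢ * (vᵢ * vᵢ)) + (aᵢ * (uᵢ * vᵢ) + aᵢ * (uᵢ * vᵢ))
               ≈ aᵢ * ((uᵢ + vᵢ) * (uᵢ + vᵢ))
      expand = solve 3 (λ a u v → (a :* (u :* u) :+ a :* (v :* v)) :+ (a :* (u :* v) :+ a :* (u :* v))
                                  := a :* ((u :+ v) :* (u :+ v))) refl

    span-isotropic⇒isotropic : ∀ {m n} (a : Fin n → Carrier) (l : Fin m → Vec F n) →
                               (∀ cs → diagForm a (lincomb F cs l) (lincomb F cs l) ≈ 0#) →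
                               ∀ i j → diagForm a (l i) (l j) ≈ 0#
    span-isotropic⇒isotropic a l isotropic i j = polarization a (isotropic-unit i) (isotropic-unit j)
      (trans (sym (diagForm-cong a lincomb-pair lincomb-pair)) (isotropic (λ k → unit i k + unit j k)))
      where
      isotropic-unit : ∀ i → diagForm a (l i) (l i) ≈ 0#
      isotropic-unit i = trans (sym (diagForm-cong a (lincomb-unit l i) (lincomb-unit l i))) (isotropic (unit i))

      lincomb-pair : ∀ x → lincomb F (λ k → unit i k + unit j k) l x ≈ l i x + l j x
      lincomb-pair x = begin
        Σᶠ F (λ k → (unit i k + unit j k) * l k x)
          ≈⟨ sum-cong-≋ (λ k → distribʳ (l k x) (unit i k) (unit j k)) ⟩
        Σᶠ F (λ k → unit i k * l k x + unit j k * l k x)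
          ≈⟨ ∑-distrib-+ (λ k → unit i k * l k x) _ ⟩
        lincomb F (unit i) l x + lincomb F (unit j) l x
          ≈⟨ +-cong (lincomb-unit l i x) (lincomb-unit l j x) ⟩
        l i x + l j x
          ∎

  -- The forms ⟨·,·⟩_d

  module _ {d k} (V : AffineFlat F d k) where
    open AffineFlat V

    private
      translate∈V : ∀ cs → _∈_ F (_⊕_ F base (lincomb F cs directions)) V
      translate∈V cs = cs , λ _ → refl

      base∈V : _∈_ F base V
      base∈V = const 0# , λ i →
        sym (trans (+-congˡ (sum-≈ε λ j → zeroˡ (directions j i))) (+-identityʳ (base i)))

      displacement : ∀ cs i → _⊖_ F (_⊕_ F base (lincomb F cs directions)) base i ≈ lincomb F cs directions i
      displacement cs i = solve 2 (λ x y → (x :+ y) :+ (:- x) := y) refl (base i) (lincomb F cs directions i)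

    span-isotropic : TotallyIsotropic F V →
                     ∀ cs → ⟨_,_⟩ F (lincomb F cs directions) (lincomb F cs directions) ≈ 0#
    span-isotropic V-isotropic cs = trans (sym (diagForm-cong (sign F d) (displacement cs) (displacement cs)))
                                          (V-isotropic _ _ (translate∈V cs) base∈V)

    directions-orthogonal : ∀ {w} → OrthogonalTo F w V → ∀ j → ⟨_,_⟩ F w (directions j) ≈ 0#
    directions-orthogonal w⊥V j =
      trans (diagForm-cong (sign F d) (λ _ → refl)
                           (λ i → sym (trans (displacement (unit j) i) (lincomb-unit directions j i))))
            (w⊥V _ _ (translate∈V (unit j)) base∈V)

  sign≉0 : ∀ d i → sign F d i ≉ 0#
  sign≉0 d i with d % 4 ℕ.≟ 1 | suc (toℕ i) ℕ.≟ d
  ... | yes _ | yes _ = -‿≉0 1≉0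
  ... | yes _ | no _  = 1≉0
  ... | no _  | _     = 1≉0

  sign-not-last : ∀ d i → suc (toℕ i) ≢ d → sign F d i ≡ 1#
  sign-not-last d i not-last with d % 4 ℕ.≟ 1 | suc (toℕ i) ℕ.≟ d
  ... | yes _ | yes last = contradiction last not-last
  ... | yes _ | no _     = ≡.refl
  ... | no _  | _        = ≡.refl

  sign-last : ∀ d i → suc (toℕ i) ≡ d → d % 4 ≡ 1 → sign F d i ≡ - 1#
  sign-last d i last d≡1 with d % 4 ℕ.≟ 1 | suc (toℕ i) ℕ.≟ d
  ... | yes _  | yes _       = ≡.refl
  ... | yes _  | no not-last = contradiction last not-last
  ... | no d≢1 | _           = contradiction d≡1 d≢1

  sign-≢1 : ∀ d i → d % 4 ≢ 1 → sign F d i ≡ 1#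
  sign-≢1 d i d≢1 with d % 4 ℕ.≟ 1
  ... | yes d≡1 = contradiction d≡1 d≢1
  ... | no _    = ≡.refl

  odd-parity : ∀ k → ((2 ℕ.* k ℕ.+ 1) % 4 ≡ 1 × (- 1#) ^ k ≈ 1#)
                   ⊎ ((2 ℕ.* k ℕ.+ 1) % 4 ≡ 3 × (- 1#) ^ k ≈ - 1#)
  odd-parity zero = inj₁ (≡.refl , refl)
  odd-parity (suc k) with odd-parity k
  ... | inj₁ (≡1 , ≈1)  = inj₂ (odd%4-step k ≡1 , trans (*-congˡ ≈1) (*-identityʳ (- 1#)))
  ... | inj₂ (≡3 , ≈-1) =
    inj₁ (odd%4-step k ≡3 , trans (*-congˡ ≈-1) (trans (-1*x≈-x (- 1#)) (-‿involutive 1#)))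

  discriminant-sign-odd : ∀ k → (- 1#) ^ k * ∏ (sign F (2 ℕ.* k ℕ.+ 1)) ≈ - 1#
  discriminant-sign-odd k with odd-parity k
  ... | inj₁ (≡1 , ≈1) = begin
    (- 1#) ^ k * ∏ (sign F d)   ≈⟨ *-cong ≈1 (∏.sum-≈ε-off last λ i i≢last →
                                     reflexive (sign-not-last d i (i≢last ∘ last-unique i))) ⟩
    1# * sign F d last          ≈⟨ *-identityˡ _ ⟩
    sign F d last               ≡⟨ sign-last d last last-is-last ≡1 ⟩
    - 1#                        ∎
    where
    d : ℕ
    d = 2 ℕ.* k ℕ.+ 1

    last : Fin d
    last = fromℕ< (ℕ.m<m+n (2 ℕ.* k) (ℕ.s≤s ℕ.z≤n))

    last-is-last : suc (toℕ last) ≡ d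
    last-is-last = ≡.trans (≡.cong suc (toℕ-fromℕ< _)) (ℕ.+-comm 1 (2 ℕ.* k))

    last-unique : ∀ i → suc (toℕ i) ≡ d → i ≡ last
    last-unique i i-is-last = toℕ-injective (ℕ.suc-injective (≡.trans i-is-last (≡.sym last-is-last)))
  ... | inj₂ (≡3 , ≈-1) = begin
    (- 1#) ^ k * ∏ (sign F d)   ≈⟨ *-cong ≈-1 (∏.sum-≈ε λ i → reflexive (sign-≢1 d i λ ≡1 →
                                     contradiction (≡.trans (≡.sym ≡3) ≡1) λ ())) ⟩
    - 1# * 1#                   ≈⟨ *-identityʳ (- 1#) ⟩
    - 1#                        ∎
    where
    d : ℕ
    d = 2 ℕ.* k ℕ.+ 1

  adjoin-unit-vector : ∀ {d k} (a : Fin d → Carrier) → (∀ i → a i ≉ 0#) →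
                       (b : Fin k → Vec F d) → LinearlyIndependent F b →
                       (∀ i j → diagForm a (b i) (b j) ≈ 0#) →
                       (w : Vec F d) → diagForm a w w ≈ 1# → (∀ j → diagForm a w (b j) ≈ 0#) →
                       NonSquare ((- 1#) ^ k * ∏ a) → Counterexample (suc k) (suc d)
  adjoin-unit-vector {d} {k} a a≉0 b b-independent b-isotropic w w-unit w⊥b nonsquare-disc = record
    { coeff       = - 1# ∷ a
    ; coeff≉0     = λ { zero → -‿≉0 1≉0 ; (suc i) → a≉0 i }
    ; basis       = basis′
    ; independent = independent′
    ; isotropic   = isotropic′
    ; nonsquare   = NonSquare-resp-≈ (begin
        (- 1#) ^ k * ∏ a                     ≈⟨ solve 2 (λ s P → s :* P := (:- s) :* (:- P))
                                                         refl ((- 1#) ^ k) (∏ a) ⟩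
        (- ((- 1#) ^ k)) * (- ∏ a)           ≈⟨ *-cong (-1*x≈-x _) (-1*x≈-x _) ⟨
        (- 1# * (- 1#) ^ k) * (- 1# * ∏ a)   ∎) nonsquare-disc
    }
    where
    basis′ : Fin (suc k) → Vec F (suc d)
    basis′ zero    = 1# ∷ w
    basis′ (suc j) = 0# ∷ b j

    isotropic′ : ∀ i j → diagForm (- 1# ∷ a) (basis′ i) (basis′ j) ≈ 0#
    isotropic′ zero    zero    = begin
      - 1# * (1# * 1#) + diagForm a w w   ≈⟨ +-cong (trans (-1*x≈-x _) (-‿cong (*-identityˡ 1#))) w-unit ⟩
      - 1# + 1#                           ≈⟨ -‿inverseˡ 1# ⟩
      0#                                  ∎
    isotropic′ zero    (suc j) = trans (+-comm _ _) (s+y*t≈0 (- 1#) (w⊥b j) (zeroʳ 1#))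
    isotropic′ (suc i) zero    = trans (+-comm _ _) (s+y*t≈0 (- 1#) (trans (diagForm-sym a (b i) w) (w⊥b i))
                                                                         (zeroˡ 1#))
    isotropic′ (suc i) (suc j) = trans (+-comm _ _) (s+y*t≈0 (- 1#) (b-isotropic i j) (zeroˡ 0#))

    independent′ : LinearlyIndependent F basis′
    independent′ cs Σ≈0 zero    = trans (sym c₀-only) (Σ≈0 zero)
      where
      c₀-only : lincomb F cs basis′ zero ≈ cs zero
      c₀-only = trans (+-congˡ (sum-≈ε λ j → zeroʳ (cs (suc j)))) (trans (+-identityʳ _) (*-identityʳ _))
    independent′ cs Σ≈0 (suc j) = b-independent (cs ∘ suc) (λ i → trans (sym (drop-c₀ i)) (Σ≈0 (suc i))) j
      where
      drop-c₀ : ∀ i → cs zero * w i + lincomb F (cs ∘ suc) b i ≈ lincomb F (cs ∘ suc) b i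
      drop-c₀ i = trans (+-congʳ (trans (*-congʳ (independent′ cs Σ≈0 zero)) (zeroˡ (w i)))) (+-identityˡ _)

open import Data.Nat.Base using (_+_; _*_)

lemma5p3 : {c ℓ : Level} (F : Field c ℓ) →
    (∀ x → ¬ (Field._≈_ F (Field._*_ F x x) (Field.-_ F (Field.1# F)))) →
    (k : ℕ) →
    ¬ (Σ (AffineFlat F (2 * k + 1) k) λ V → Σ (Vec F (2 * k + 1)) λ w →
         TotallyIsotropic F V × Field._≈_ F (⟨_,_⟩ F w w) (Field.1# F) × OrthogonalTo F w V)
lemma5p3 F -1-nonsquare k (V , w , V-isotropic , w-unit , w⊥V) =
  no-counterexample (suc k) (≡.subst (Counterexample (suc k)) (suc-odd≡double k) extended)
  where
  open QuadraticSpaces F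
  open Char≢2 (NonSquare[-1]⇒1+1≉0 -1-nonsquare)
  open Field F using (sym)
  open AffineFlat V using (directions; independent)

  extended : Counterexample (suc k) (suc (2 * k + 1))
  extended = adjoin-unit-vector (sign F _) (sign≉0 _) directions independent
    (span-isotropic⇒isotropic (sign F _) directions (span-isotropic V V-isotropic))
    w w-unit (directions-orthogonal V w⊥V)
    (NonSquare-resp-≈ (sym (discriminant-sign-odd k)) -1-nonsquare)
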